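{- The decision problem FireFighting can be polynomially reduced to the decision problem FireFightingInTime.
   Context: All graphs are finite, simple and undirected. For a graph $G=(V,E)$ and $W\subseteq V$, $N(W)$ is the set of nodes in $V\setminus W$ adjacent to at least one node of $W$. For $m\in\mathbb{N}_{>0}$, an $m$-strategy of length $T$ is a sequence $(F_1,\dots,F_T)$ of subsets of $V$ with $|F_i|\le m$. Its burning sets are $B_0=V$ and $B_t=(B_{t-1}\setminus F_t)\cup N(B_{t-1}\setminus F_t)$ for $t\ge1$, where $F_t=\emptyset$ for $t>T$. The strategy is winning if $B_T=\emptyset$. $\text{ffn}(G)$ is the smallest $m$ admitting a winning $m$-strategy. FireFighting: given $G$ and $m\in\mathbb{N}_{>0}$, decide whether $\text{ffn}(G)\le m$. FireFightingInTime: given $G$, $m\in\mathbb{N}_{>0}$ and $T\in\mathbb{N}_{>0}$ (encoded in binary), decide whether there is a winning $m$-strategy for $G$ of length $T$. -}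

module Defs where

open import Data.Nat using (ℕ; zero; suc; _+_; _*_; _^_; _≤_; _<_)
open import Data.Nat.Binary.Base using (ℕᵇ; 2[1+_]; 1+[2_]) renaming (zero to zeroᵇ; fromℕ to toℕᵇ)
open import Data.Bool using (Bool; true; false; _∧_; _∨_; not; if_then_else_)
open import Data.Fin using (Fin) renaming (zero to fzero; suc to fsuc)
open import Data.Fin.Subset using (Subset; ⊤; ⊥; _─_; _∪_; ∣_∣)
open import Data.Vec using (Vec; []; _∷_; tabulate; lookup)
open import Data.Vec.Relation.Unary.All using (All)
open import Data.List using (List; []; _∷_; _++_; length; concatMap; allFin; map)
open import Data.Product using (Σ; _×_; _,_; ∃; ∃-syntax)
open import Function.Bundles using (_⇔_)
open import Relation.Binary.PropositionalEquality using (_≡_)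

record Graph : Set where
  field
    n      : ℕ
    adj    : Fin n → Fin n → Bool
    sym    : ∀ u v → adj u v ≡ adj v u
    irrefl : ∀ v → adj v v ≡ false
open Graph public

anyFin : ∀ {k} → (Fin k → Bool) → Bool
anyFin {zero}  p = false
anyFin {suc k} p = p fzero ∨ anyFin (λ i → p (fsuc i))

N : (G : Graph) → Subset (n G) → Subset (n G)
N G W = tabulate λ v → not (lookup W v) ∧ anyFin (λ u → lookup W u ∧ adj G u v)

burnStep : (G : Graph) → Subset (n G) → Subset (n G) → Subset (n G)
burnStep G B F = (B ─ F) ∪ N G (B ─ F)

burnFrom : (G : Graph) → Subset (n G) → ∀ {T} → Vec (Subset (n G)) T → Subset (n G)
burnFrom G B []       = B
burnFrom G B (F ∷ Fs) = burnFrom G (burnStep G B F) Fs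

burning : (G : Graph) → ∀ {T} → Vec (Subset (n G)) T → Subset (n G)
burning G Fs = burnFrom G ⊤ Fs

IsStrategy : (G : Graph) (m : ℕ) → ∀ {T} → Vec (Subset (n G)) T → Set
IsStrategy G m Fs = All (λ F → ∣ F ∣ ≤ m) Fs

WinningStrategy : (G : Graph) (m T : ℕ) → Set
WinningStrategy G m T =
  Σ (Vec (Subset (n G)) T) λ Fs → IsStrategy G m Fs × burning G Fs ≡ ⊥

ffn≤ : Graph → ℕ → Set
ffn≤ G m = ∃[ m' ] (0 < m' × m' ≤ m × ∃[ T ] WinningStrategy G m' T)

record FFInstance : Set where
  field
    graph : Graph
    m     : ℕ
    m>0   : 0 < m

record FFTInstance : Set where
  field
    graph : Graph
    m     : ℕ
    T     : ℕ
    m>0   : 0 < m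
    T>0   : 0 < T

FireFighting : FFInstance → Set
FireFighting I = ffn≤ (FFInstance.graph I) (FFInstance.m I)

FireFightingInTime : FFTInstance → Set
FireFightingInTime I =
  WinningStrategy (FFTInstance.graph I) (FFTInstance.m I) (FFTInstance.T I)

data Sym : Set where
  b0 b1 sep : Sym

-- (bijective) binary numeral, length O(log n); used for n, m and T
encℕᵇ : ℕᵇ → List Sym
encℕᵇ zeroᵇ     = []
encℕᵇ 2[1+ x ]  = b1 ∷ encℕᵇ x
encℕᵇ 1+[2 x ]  = b0 ∷ encℕᵇ x

encℕ : ℕ → List Sym
encℕ k = encℕᵇ (toℕᵇ k)

bit : Bool → Sym
bit true  = b1
bit false = b0

encGraph : Graph → List Sym
encGraph G = encℕ (n G) ++ sep ∷
  concatMap (λ u → map (λ v → bit (adj G u v)) (allFin (n G))) (allFin (n G))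

encFF : FFInstance → List Sym
encFF I = encGraph (FFInstance.graph I) ++ sep ∷ encℕ (FFInstance.m I)

encFFT : FFTInstance → List Sym
encFFT I = encGraph (FFTInstance.graph I) ++ sep ∷ encℕ (FFTInstance.m I)
           ++ sep ∷ encℕ (FFTInstance.T I)

data Move : Set where
  L R S : Move

-- tape alphabet Fin (4 + k): 0 = blank, 1,2,3 = the input symbols b0,b1,#
record TM : Set where
  field
    states : ℕ
    extra  : ℕ
    start  : Fin states
    halt   : Fin states
    δ      : Fin states → Fin (4 + extra) → Fin states × Fin (4 + extra) × Move

module _ (M : TM) where
  open TM M

  Γ : Set
  Γ = Fin (4 + extra)

  blank : Γ
  blank = fzero

  symΓ : Sym → Γ
  symΓ b0  = fsuc fzero
  symΓ b1  = fsuc (fsuc fzero)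
  symΓ sep = fsuc (fsuc (fsuc fzero))

  record Config : Set where
    constructor cfg
    field
      state : Fin states
      head  : ℕ
      tape  : ℕ → Γ

  written : List Sym → ℕ → Γ
  written []       _       = blank
  written (s ∷ w)  zero    = symΓ s
  written (s ∷ w)  (suc i) = written w i

  initial : List Sym → Config
  initial w = cfg start 0 (written w)

  _≟ℕ_ : ℕ → ℕ → Bool
  zero  ≟ℕ zero  = true
  suc a ≟ℕ suc b = a ≟ℕ b
  _     ≟ℕ _     = false

  _≟Q_ : ∀ {k} → Fin k → Fin k → Bool
  fzero  ≟Q fzero  = true
  fsuc a ≟Q fsuc b = a ≟Q b
  _      ≟Q _      = false

  move : Move → ℕ → ℕ
  move L zero    = zero
  move L (suc h) = h
  move R h       = suc h
  move S h       = h

  step : Config → Config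
  step (cfg q h t) with q ≟Q halt
  ... | true  = cfg q h t
  ... | false with δ q (t h)
  ...   | q' , a , d = cfg q' (move d h) (λ i → if i ≟ℕ h then a else t i)

  run : ℕ → Config → Config
  run zero    c = c
  run (suc k) c = run k (step c)

  ComputesWithin : ℕ → List Sym → List Sym → Set
  ComputesWithin t w y =
    ∃[ s ] (s ≤ t × Config.state (run s (initial w)) ≡ halt
                  × (∀ i → Config.tape (run s (initial w)) i ≡ written y i))

PolyTimeComputable : {A B : Set} → (A → List Sym) → (B → List Sym) → (A → B) → Set
PolyTimeComputable encA encB f =
  Σ TM λ M → ∃[ c ] (∀ x →
    ComputesWithin M (c * (suc (length (encA x))) ^ c) (encA x) (encB (f x)))

PolyReduction : Set
PolyReduction =
  Σ (FFInstance → FFTInstance) λ f →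
    PolyTimeComputable encFF encFFT f × (∀ I → FireFighting I ⇔ FireFightingInTime (f I))

-- A winning strategy never needs to pass through the same burning set twice: the moves between
-- two equal burning sets can be cut out. So some winning strategy has length below 2^|V|, and
-- padding it with empty moves (an empty burning set stays empty) gives one of any length
-- T ≥ 2^|V| − 1. The reduction keeps G and m and takes for T the bijective binary numeral of
-- ℓ ones, ℓ ≥ |V| the length of the encoded instance, whose value is 2^(ℓ+1) − 2. Appending
-- '#1…1' to the input is done by a Turing machine that marks the input symbols one at a time
-- and appends a 1 for each, in 2(ℓ+1)² steps.
module Submission where

open import Defs hiding (sym)
open import Data.Bool using (Bool; true; false; not; _∧_; if_then_else_)
open import Data.Fin as Fin using (Fin; toℕ; finToFun; funToFin)
open import Data.Fin.Patterns
open import Data.Fin.Properties using (pigeonhole; toℕ≤pred[n]; finToFun-funToFin; 2↔Bool)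
open import Data.Fin.Subset using (Subset; ⊤; ⊥; ∣_∣)
open import Data.Fin.Subset.Properties using (∣⊥∣≡0; p─⊥≡p; ∪-idem)
open import Data.List using (List; []; _∷_; _++_; _ʳ++_; length; map; reverse; replicate; foldl; take; drop; concatMap; allFin)
open import Data.List.Properties
  using (ʳ++-defn; ++-ʳ++; ++-assoc; ++-identityʳ; foldl-++; take++drop≡id; map-++; map-replicate;
         length-reverse; length-map; length-++; length-replicate; length-take; length-drop; length-tabulate;
         length-++-≤ˡ; length-++-≤ʳ)
open import Data.List.Relation.Binary.Pointwise as Pointwise using (Pointwise; []; _∷_)
open import Data.List.Relation.Unary.All using (All)
import Data.List.Relation.Unary.All.Properties as All
open import Data.Maybe using (Maybe; just; nothing)
open import Data.Nat using (ℕ; zero; suc; _+_; _*_; _∸_; _^_; _⊓_; _≤_; _<_; z≤n; s≤s; _<?_)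
open import Data.Nat.Binary.Base as ℕᵇ using (ℕᵇ; 2[1+_])
open import Data.Nat.Binary.Properties using (fromℕ-toℕ)
open import Data.Nat.Induction using (<-wellFounded)
open import Data.Nat.Properties
  using (≤-refl; ≤-reflexive; ≤-trans; ≤-pred; n≤1+n; <-≤-trans; ≮⇒≥; m⊓n≤m; m+[n∸m]≡n;
         +-comm; +-suc; +-identityʳ; +-monoˡ-≤; +-monoˡ-<; *-monoʳ-≤; ^-monoʳ-≤; ^-identityʳ; module ≤-Reasoning)
open import Data.Nat.Tactic.RingSolver using (solve-∀)
open import Data.Product using (_×_; _,_; proj₁; proj₂; ∃-syntax)
open import Data.Vec as Vec using (Vec; []; _∷_; lookup; tabulate; padRight)
open import Data.Vec.Properties using (tabulate-cong; tabulate∘lookup; lookup-replicate)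
open import Data.Vec.Relation.Unary.All as VecAll using ([]; _∷_)
import Data.Vec.Relation.Unary.All.Properties as VecAll
open import Function using (_∘_)
open import Function.Definitions using (Injective)
open import Function.Bundles using (Inverse; _⇔_; mk⇔)
open import Induction.WellFounded using (Acc; acc)
open import Relation.Binary.PropositionalEquality
open import Relation.Nullary using (yes; no)

module LoopRemoval {S A : Set} {N : ℕ} (code : S → Fin N) (code-injective : Injective _≡_ _≡_ code)
                   (f : S → A → S) {P : A → Set} where

  removeLoop : ∀ s xs → N ≤ length xs → All P xs →
               ∃[ ys ] (All P ys × foldl f s ys ≡ foldl f s xs × length ys < length xs)
  removeLoop s xs N≤len pxs with pigeonhole (s≤s N≤len) (λ k → code (foldl f s (take (toℕ k) xs)))
  ... | i , j , i<j , same-code =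
    take a xs ++ drop b xs , All.++⁺ (All.take⁺ a pxs) (All.drop⁺ b pxs) , same-end , shorter
    where
    a = toℕ i
    b = toℕ j
    b≤len : b ≤ length xs
    b≤len = toℕ≤pred[n] j
    same-end : foldl f s (take a xs ++ drop b xs) ≡ foldl f s xs
    same-end = begin
      foldl f s (take a xs ++ drop b xs)             ≡⟨ foldl-++ f s (take a xs) (drop b xs) ⟩
      foldl f (foldl f s (take a xs)) (drop b xs)    ≡⟨ cong (λ t → foldl f t (drop b xs)) (code-injective same-code) ⟩
      foldl f (foldl f s (take b xs)) (drop b xs)    ≡⟨ foldl-++ f s (take b xs) (drop b xs) ⟨
      foldl f s (take b xs ++ drop b xs)             ≡⟨ cong (foldl f s) (take++drop≡id b xs) ⟩
      foldl f s xs                                   ∎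
      where open ≡-Reasoning
    shorter : length (take a xs ++ drop b xs) < length xs
    shorter = begin-strict
      length (take a xs ++ drop b xs)          ≡⟨ length-++ (take a xs) ⟩
      length (take a xs) + length (drop b xs)  ≡⟨ cong₂ _+_ (length-take a xs) (length-drop b xs) ⟩
      a ⊓ length xs + (length xs ∸ b)          ≤⟨ +-monoˡ-≤ _ (m⊓n≤m a _) ⟩
      a + (length xs ∸ b)                      <⟨ +-monoˡ-< _ i<j ⟩
      b + (length xs ∸ b)                      ≡⟨ m+[n∸m]≡n b≤len ⟩
      length xs                                ∎
      where open ≤-Reasoning

  shortcut : ∀ s xs → All P xs → ∃[ ys ] (All P ys × foldl f s ys ≡ foldl f s xs × length ys < N)
  shortcut s xs = go xs (<-wellFounded (length xs))
    where
    go : ∀ xs → Acc _<_ (length xs) → All P xs → ∃[ ys ] (All P ys × foldl f s ys ≡ foldl f s xs × length ys < N)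
    go xs (acc rec) pxs with length xs <? N
    ... | yes short = xs , pxs , refl , short
    ... | no long with removeLoop s xs (≮⇒≥ long) pxs
    ...   | ys , pys , same , ys<xs with go ys (rec ys<xs) pys
    ...     | zs , pzs , same′ , short = zs , pzs , trans same′ same , short

-- Winning strategies of every sufficiently large length

subsetCode : ∀ {k} → Subset k → Fin (2 ^ k)
subsetCode W = funToFin (Inverse.from 2↔Bool ∘ lookup W)

codeSubset : ∀ {k} → Fin (2 ^ k) → Subset k
codeSubset c = tabulate (Inverse.to 2↔Bool ∘ finToFun c)

codeSubset∘subsetCode : ∀ {k} (W : Subset k) → codeSubset (subsetCode W) ≡ W
codeSubset∘subsetCode W = trans (tabulate-cong λ i → trans (cong (Inverse.to 2↔Bool) (finToFun-funToFin _ i))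
                                                          (Inverse.strictlyInverseˡ 2↔Bool (lookup W i)))
                                (tabulate∘lookup W)

subsetCode-injective : ∀ {k} → Injective _≡_ _≡_ (subsetCode {k})
subsetCode-injective {x = W} {W′} eq =
  trans (sym (codeSubset∘subsetCode W)) (trans (cong codeSubset eq) (codeSubset∘subsetCode W′))

anyFin-false : ∀ {k} (p : Fin k → Bool) → (∀ u → p u ≡ false) → anyFin p ≡ false
anyFin-false {zero}  p p≡false = refl
anyFin-false {suc k} p p≡false rewrite p≡false 0F = anyFin-false (p ∘ Fin.suc) (p≡false ∘ Fin.suc)

N-⊥ : ∀ G → N G ⊥ ≡ ⊥
N-⊥ G = trans (tabulate-cong no-neighbour) (tabulate∘lookup ⊥)
  where
  no-neighbour : ∀ v → not (lookup ⊥ v) ∧ anyFin (λ u → lookup ⊥ u ∧ adj G u v) ≡ lookup ⊥ v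
  no-neighbour v rewrite lookup-replicate v false =
    anyFin-false _ λ u → cong (_∧ adj G u v) (lookup-replicate u false)

burnStep-⊥ : ∀ G → burnStep G ⊥ ⊥ ≡ ⊥
burnStep-⊥ G rewrite p─⊥≡p (⊥ {n G}) | N-⊥ G = ∪-idem ⊥

burnFrom-foldl : ∀ G B {T} (Fs : Vec (Subset (n G)) T) → burnFrom G B Fs ≡ foldl (burnStep G) B (Vec.toList Fs)
burnFrom-foldl G B []       = refl
burnFrom-foldl G B (F ∷ Fs) = burnFrom-foldl G (burnStep G B F) Fs

burnFrom-fromList : ∀ G B Fs → burnFrom G B (Vec.fromList Fs) ≡ foldl (burnStep G) B Fs
burnFrom-fromList G B []       = refl
burnFrom-fromList G B (F ∷ Fs) = burnFrom-fromList G (burnStep G B F) Fs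

burnFrom-⊥ : ∀ G k → burnFrom G ⊥ (Vec.replicate k ⊥) ≡ ⊥
burnFrom-⊥ G zero    = refl
burnFrom-⊥ G (suc k) rewrite burnStep-⊥ G = burnFrom-⊥ G k

burnFrom-padRight : ∀ G {B k T} (k≤T : k ≤ T) (Fs : Vec (Subset (n G)) k) →
                    burnFrom G B Fs ≡ ⊥ → burnFrom G B (padRight k≤T ⊥ Fs) ≡ ⊥
burnFrom-padRight G {T = T} z≤n [] refl = burnFrom-⊥ G T
burnFrom-padRight G (s≤s k≤T) (F ∷ Fs) burnt = burnFrom-padRight G k≤T Fs burnt

padRight⁺ : ∀ {A : Set} {P : A → Set} {k T a} (k≤T : k ≤ T) {xs : Vec A k} →
            P a → VecAll.All P xs → VecAll.All P (padRight k≤T a xs)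
padRight⁺ {P = P} z≤n       pa []         = VecAll.lookup⁻ λ i → subst P (sym (lookup-replicate i _)) pa
padRight⁺         (s≤s k≤T) pa (px ∷ pxs) = px ∷ padRight⁺ k≤T pa pxs

weaken : ∀ G {m′ m T} → m′ ≤ m → WinningStrategy G m′ T → WinningStrategy G m T
weaken G m′≤m (Fs , small , burnt) = Fs , VecAll.map (λ |F|≤m′ → ≤-trans |F|≤m′ m′≤m) small , burnt

winning-in-time : ∀ G {m T T′} → 2 ^ n G ≤ suc T → WinningStrategy G m T′ → WinningStrategy G m T
winning-in-time G {m} 2^n≤1+T (Fs , small , burnt)
  with LoopRemoval.shortcut subsetCode subsetCode-injective (burnStep G) ⊤ (Vec.toList Fs) (VecAll.toList⁺ small)
... | Fs′ , small′ , same , short =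
  padRight len≤T ⊥ (Vec.fromList Fs′) ,
  padRight⁺ len≤T (subst (_≤ m) (sym (∣⊥∣≡0 (n G))) z≤n) (VecAll.fromList⁺ small′) ,
  burnFrom-padRight G len≤T _ (trans (burnFrom-fromList G ⊤ Fs′) (trans same (trans (sym (burnFrom-foldl G ⊤ Fs)) burnt)))
  where
  len≤T = ≤-pred (≤-trans short 2^n≤1+T)

onesᵇ : ℕ → ℕᵇ
onesᵇ zero    = ℕᵇ.zero
onesᵇ (suc ℓ) = 2[1+ onesᵇ ℓ ]

horizon : ℕ → ℕ
horizon ℓ = ℕᵇ.toℕ (onesᵇ ℓ)

encℕ-horizon : ∀ ℓ → encℕ (horizon ℓ) ≡ replicate ℓ b1
encℕ-horizon ℓ = trans (cong encℕᵇ (fromℕ-toℕ (onesᵇ ℓ))) (encℕᵇ-onesᵇ ℓ)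
  where
  encℕᵇ-onesᵇ : ∀ ℓ → encℕᵇ (onesᵇ ℓ) ≡ replicate ℓ b1
  encℕᵇ-onesᵇ zero    = refl
  encℕᵇ-onesᵇ (suc ℓ) = cong (b1 ∷_) (encℕᵇ-onesᵇ ℓ)

2^≤1+horizon : ∀ ℓ → 2 ^ ℓ ≤ suc (horizon ℓ)
2^≤1+horizon zero    = s≤s z≤n
2^≤1+horizon (suc ℓ) = ≤-trans (*-monoʳ-≤ 2 (2^≤1+horizon ℓ)) (n≤1+n _)

horizon-positive : ∀ {ℓ} → 0 < ℓ → 0 < horizon ℓ
horizon-positive {suc ℓ} _ = s≤s z≤n

side≤length-matrix : ∀ {A : Set} k (row : Fin k → List A) → (∀ u → length (row u) ≡ k) →
                     k ≤ length (concatMap row (allFin k))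
side≤length-matrix zero    row row-length = z≤n
side≤length-matrix (suc k) row row-length =
  subst (_≤ length (concatMap row (allFin (suc k)))) (row-length 0F) (length-++-≤ˡ (row 0F))

vertices≤length-encFF : ∀ I → n (FFInstance.graph I) ≤ length (encFF I)
vertices≤length-encFF I =
  ≤-trans (side≤length-matrix (n G) row λ u → trans (length-map _ (allFin (n G))) (length-tabulate (λ v → v))) (
  ≤-trans (n≤1+n _) (
  ≤-trans (length-++-≤ʳ (sep ∷ concatMap row (allFin (n G))) {encℕ (n G)})
          (length-++-≤ˡ (encGraph G))))
  where
  G = FFInstance.graph I
  row = λ u → map (λ v → bit (adj G u v)) (allFin (n G))

encFF-nonempty : ∀ I → 0 < length (encFF I)
encFF-nonempty I = <-≤-trans (s≤s z≤n) (length-++-≤ʳ (sep ∷ encℕ (FFInstance.m I)) {encGraph (FFInstance.graph I)})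

reduce : FFInstance → FFTInstance
reduce I = record
  { graph = FFInstance.graph I
  ; m     = FFInstance.m I
  ; T     = horizon (length (encFF I))
  ; m>0   = FFInstance.m>0 I
  ; T>0   = horizon-positive (encFF-nonempty I)
  }

encFFT-reduce : ∀ I → encFFT (reduce I) ≡ encFF I ++ sep ∷ replicate (length (encFF I)) b1
encFFT-reduce I = trans (sym (++-assoc (encGraph (FFInstance.graph I)) (sep ∷ encℕ (FFInstance.m I)) _))
                        (cong (λ t → encFF I ++ sep ∷ t) (encℕ-horizon (length (encFF I))))

reduce-correct : ∀ I → FireFighting I ⇔ FireFightingInTime (reduce I)
reduce-correct I = mk⇔ (λ (m′ , _ , m′≤m , _ , win) → winning-in-time G horizon-long-enough (weaken G m′≤m win))
                       (λ win → FFInstance.m I , FFInstance.m>0 I , ≤-refl , _ , win)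
  where
  G = FFInstance.graph I
  horizon-long-enough : 2 ^ n G ≤ suc (horizon (length (encFF I)))
  horizon-long-enough = ≤-trans (^-monoʳ-≤ 2 (vertices≤length-encFF I)) (2^≤1+horizon (length (encFF I)))

-- Running Turing machines on a tape zipper

module TapeZipper (M : TM) where
  open TM M

  tapeOf : List (Γ M) → ℕ → Γ M
  tapeOf []       _       = blank M
  tapeOf (a ∷ as) zero    = a
  tapeOf (a ∷ as) (suc i) = tapeOf as i

  overwrite : ℕ → Γ M → (ℕ → Γ M) → ℕ → Γ M
  overwrite h b t i = if _≟ℕ_ M i h then b else t i

  tapeOf-++-∷ : ∀ xs {a rs} → tapeOf (xs ++ a ∷ rs) (length xs) ≡ a
  tapeOf-++-∷ []       = refl
  tapeOf-++-∷ (x ∷ xs) = tapeOf-++-∷ xs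

  overwrite-++-∷ : ∀ xs {a b rs} → overwrite (length xs) b (tapeOf (xs ++ a ∷ rs)) ≗ tapeOf (xs ++ b ∷ rs)
  overwrite-++-∷ []       zero    = refl
  overwrite-++-∷ []       (suc i) = refl
  overwrite-++-∷ (x ∷ xs) zero    = refl
  overwrite-++-∷ (x ∷ xs) (suc i) = overwrite-++-∷ xs i

  tapeOf-++-blank : ∀ xs → tapeOf (xs ++ []) ≗ tapeOf (xs ++ blank M ∷ [])
  tapeOf-++-blank []       zero    = refl
  tapeOf-++-blank []       (suc i) = refl
  tapeOf-++-blank (x ∷ xs) zero    = refl
  tapeOf-++-blank (x ∷ xs) (suc i) = tapeOf-++-blank xs i

  -- `left` holds the cells left of the head, nearest first; `right` starts with the head cell.
  data Zipper : Set where
    ⟨_∣_∣_⟩ : (q : Fin states) (left right : List (Γ M)) → Zipper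

  ⟦_⟧ : Zipper → Config M
  ⟦ ⟨ q ∣ ls ∣ rs ⟩ ⟧ = cfg q (length ls) (tapeOf (ls ʳ++ rs))

  moveHead : Move → Zipper → Zipper
  moveHead L ⟨ q ∣ l ∷ ls ∣ rs     ⟩ = ⟨ q ∣ ls     ∣ l ∷ rs ⟩
  moveHead R ⟨ q ∣ ls     ∣ r ∷ rs ⟩ = ⟨ q ∣ r ∷ ls ∣ rs     ⟩
  moveHead R ⟨ q ∣ ls     ∣ []     ⟩ = ⟨ q ∣ blank M ∷ ls ∣ [] ⟩
  moveHead _ z                       = z

  _≈_ : Config M → Config M → Set
  c ≈ d = Config.state c ≡ Config.state d × Config.head c ≡ Config.head d × Config.tape c ≗ Config.tape d

  ≈-refl : ∀ {c} → c ≈ c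
  ≈-refl = refl , refl , λ _ → refl

  ≈-trans : ∀ {c d e} → c ≈ d → d ≈ e → c ≈ e
  ≈-trans (q≡ , h≡ , t≗) (q≡′ , h≡′ , t≗′) = trans q≡ q≡′ , trans h≡ h≡′ , λ i → trans (t≗ i) (t≗′ i)

  step-cong : ∀ {c d} → c ≈ d → step M c ≈ step M d
  step-cong {cfg q h t} {cfg _ _ t′} (refl , refl , t≗t′) with _≟Q_ M q halt
  ... | true  = refl , refl , t≗t′
  ... | false rewrite t≗t′ h with δ q (t′ h)
  ...   | q′ , b , d = refl , refl , λ i → cong (if _≟ℕ_ M i h then b else_) (t≗t′ i)

  run-cong : ∀ k {c d} → c ≈ d → run M k c ≈ run M k d
  run-cong zero    c≈d = c≈d
  run-cong (suc k) c≈d = run-cong k (step-cong c≈d)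

  run-+ : ∀ a b c → run M (a + b) c ≡ run M b (run M a c)
  run-+ zero    b c = refl
  run-+ (suc a) b c = run-+ a b (step M c)

  transition : Fin states → Γ M → Maybe (Fin states × Γ M × Move)
  transition q a = if _≟Q_ M q halt then nothing else just (δ q a)

  step-transition : ∀ {q h t q′ b d} → transition q (t h) ≡ just (q′ , b , d) →
             step M (cfg q h t) ≡ cfg q′ (move M d h) (overwrite h b t)
  step-transition {q} {h} {t} eq with _≟Q_ M q halt
  ... | false with δ q (t h)
  ...   | _ with refl ← eq = refl

  read-head : ∀ ls {a rs} → tapeOf (ls ʳ++ a ∷ rs) (length ls) ≡ a
  read-head ls {a} {rs} = begin
    tapeOf (ls ʳ++ a ∷ rs) (length ls)                   ≡⟨ cong₂ tapeOf (ʳ++-defn ls) (sym (length-reverse ls)) ⟩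
    tapeOf (reverse ls ++ a ∷ rs) (length (reverse ls))  ≡⟨ tapeOf-++-∷ (reverse ls) ⟩
    a                                                    ∎
    where open ≡-Reasoning

  write-head : ∀ ls {a b rs} → overwrite (length ls) b (tapeOf (ls ʳ++ a ∷ rs)) ≗ tapeOf (ls ʳ++ b ∷ rs)
  write-head ls {a} {b} {rs} i
    rewrite ʳ++-defn ls {a ∷ rs} | ʳ++-defn ls {b ∷ rs} | sym (length-reverse ls) = overwrite-++-∷ (reverse ls) i

  move-⟦⟧ : ∀ d q ls b rs → cfg q (move M d (length ls)) (tapeOf (ls ʳ++ b ∷ rs)) ≈ ⟦ moveHead d ⟨ q ∣ ls ∣ b ∷ rs ⟩ ⟧
  move-⟦⟧ L q []       b rs = ≈-refl
  move-⟦⟧ L q (l ∷ ls) b rs = ≈-refl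
  move-⟦⟧ R q ls       b rs = ≈-refl
  move-⟦⟧ S q ls       b rs = ≈-refl

  infix 4 _⟶[_]_
  record _⟶[_]_ (z : Zipper) (k : ℕ) (z′ : Zipper) : Set where
    constructor runs
    field ran : run M k ⟦ z ⟧ ≈ ⟦ z′ ⟧

  ⟶-step : ∀ {q a q′ b d ls rs} → transition q a ≡ just (q′ , b , d) →
           ⟨ q ∣ ls ∣ a ∷ rs ⟩ ⟶[ 1 ] moveHead d ⟨ q′ ∣ ls ∣ b ∷ rs ⟩
  ⟶-step {q} {a} {q′} {b} {d} {ls} {rs} eq =
    runs (subst (_≈ _) (sym stepped) (≈-trans (refl , refl , write-head ls) (move-⟦⟧ d q′ ls b rs)))
    where
    stepped = step-transition {t = tapeOf (ls ʳ++ a ∷ rs)} (trans (cong (transition q) (read-head ls)) eq)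

  blank-padding : ∀ {q ls} → ⟨ q ∣ ls ∣ [] ⟩ ⟶[ 0 ] ⟨ q ∣ ls ∣ blank M ∷ [] ⟩
  blank-padding {q} {ls} = runs (refl , refl , λ i →
    subst₂ (λ xs ys → tapeOf xs i ≡ tapeOf ys i) (sym (ʳ++-defn ls)) (sym (ʳ++-defn ls)) (tapeOf-++-blank (reverse ls) i))

  ⟶-refl : ∀ {z} → z ⟶[ 0 ] z
  ⟶-refl = runs ≈-refl

  ⟶-trans : ∀ {z z′ z″ a b} → z ⟶[ a ] z′ → z′ ⟶[ b ] z″ → z ⟶[ a + b ] z″
  ⟶-trans {z} {a = a} {b} (runs z⟶z′) (runs z′⟶z″) =
    runs (subst (_≈ _) (sym (run-+ a b ⟦ z ⟧)) (≈-trans (run-cong b z⟶z′) z′⟶z″))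

  ⟶-cast : ∀ {z z′ a b} → a ≡ b → z ⟶[ a ] z′ → z ⟶[ b ] z′
  ⟶-cast refl z⟶z′ = z⟶z′

  module ⟶-Reasoning where
    infix  1 begin_
    infixr 2 _⟶⟨_⟩_ _≡⟨_⟩_
    infix  3 _∎

    begin_ : ∀ {z z′ k} → z ⟶[ k ] z′ → z ⟶[ k ] z′
    begin z⟶z′ = z⟶z′

    _⟶⟨_⟩_ : ∀ z {z′ z″ a b} → z ⟶[ a ] z′ → z′ ⟶[ b ] z″ → z ⟶[ a + b ] z″
    _ ⟶⟨ z⟶z′ ⟩ z′⟶z″ = ⟶-trans z⟶z′ z′⟶z″

    _≡⟨_⟩_ : ∀ z {z′ z″ k} → z ≡ z′ → z′ ⟶[ k ] z″ → z ⟶[ k ] z″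
    _ ≡⟨ refl ⟩ z⟶z″ = z⟶z″

    _∎ : ∀ z → z ⟶[ 0 ] z
    _ ∎ = ⟶-refl

  Sweeps : Fin states → Move → Γ M → Γ M → Set
  Sweeps q d a b = transition q a ≡ just (q , b , d)

  sweepR : ∀ {q ls xs ys rs} → Pointwise (Sweeps q R) xs ys →
           ⟨ q ∣ ls ∣ xs ++ rs ⟩ ⟶[ length xs ] ⟨ q ∣ ys ʳ++ ls ∣ rs ⟩
  sweepR []            = ⟶-refl
  sweepR (x↦y ∷ xs↦ys) = ⟶-trans (⟶-step x↦y) (sweepR xs↦ys)

  sweepL : ∀ {p q a b ls xs ys rs} → transition p a ≡ just (q , b , L) → Pointwise (Sweeps q L) xs ys →
           ⟨ p ∣ xs ʳ++ ls ∣ a ∷ rs ⟩ ⟶[ suc (length xs) ] moveHead L ⟨ q ∣ ls ∣ ys ++ b ∷ rs ⟩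
  sweepL turn []            = ⟶-step turn
  sweepL turn (x↦y ∷ xs↦ys) = ⟶-cast (+-comm _ 1) (⟶-trans (sweepL turn xs↦ys) (⟶-step x↦y))

  written≗tapeOf : ∀ w → written M w ≗ tapeOf (map (symΓ M) w)
  written≗tapeOf []      _       = refl
  written≗tapeOf (x ∷ w) zero    = refl
  written≗tapeOf (x ∷ w) (suc i) = written≗tapeOf w i

  computesWithin : ∀ {t s w y} → s ≤ t →
                   ⟨ start ∣ [] ∣ map (symΓ M) w ⟩ ⟶[ s ] ⟨ halt ∣ [] ∣ map (symΓ M) y ⟩ → ComputesWithin M t w y
  computesWithin {s = s} {w} {y} s≤t (runs w⟶y) =
    s , s≤t , proj₁ run≈ , λ i → trans (proj₂ (proj₂ run≈) i) (sym (written≗tapeOf y i))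
    where run≈ = ≈-trans (run-cong s (refl , refl , written≗tapeOf w)) w⟶y

-- A machine appending # and the unary length of its input

pattern scan    = 0F
pattern seekSep = 1F
pattern seekEnd = 2F
pattern return  = 3F
pattern unmark  = 4F
pattern done    = 5F

-- 1F–3F are the input symbols b0, b1, sep; 4F–6F their marked copies; 7F separates
-- the input from the unary counter while the counter is being built.
pattern ␣    = 0F
pattern in0  = 1F
pattern in1  = 2F
pattern in#  = 3F
pattern mk0  = 4F
pattern mk1  = 5F
pattern mk#  = 6F
pattern tsep = 7F

-- Each round marks the leftmost unmarked input symbol, appends a 1 behind the separator 7F and
-- walks back. When no unmarked symbol is left, 7F becomes # and the input is unmarked right to left.
δ : Fin 6 → Fin 8 → Fin 6 × Fin 8 × Move
δ scan    in0  = seekSep , mk0  , R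
δ scan    in1  = seekSep , mk1  , R
δ scan    in#  = seekSep , mk#  , R
δ scan    tsep = unmark  , in#  , L
δ seekSep ␣    = seekEnd , tsep , R
δ seekSep tsep = seekEnd , tsep , R
δ seekSep a    = seekSep , a    , R
δ seekEnd ␣    = return  , in1  , L
δ seekEnd a    = seekEnd , a    , R
δ return  mk0  = scan    , mk0  , R
δ return  mk1  = scan    , mk1  , R
δ return  mk#  = scan    , mk#  , R
δ return  a    = return  , a    , L
δ unmark  mk0  = unmark  , in0  , L
δ unmark  mk1  = unmark  , in1  , L
δ unmark  mk#  = unmark  , in#  , L
-- In particular unmark halts on the unmarked first symbol, reached by bouncing off the left end.
δ _       a    = done    , a    , S

appendUnaryLength : TM
appendUnaryLength = record { states = 6 ; extra = 4 ; start = scan ; halt = done ; δ = δ }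

open TapeZipper appendUnaryLength

sy : Sym → Γ appendUnaryLength
sy = symΓ appendUnaryLength

marked : Sym → Γ appendUnaryLength
marked b0  = mk0
marked b1  = mk1
marked sep = mk#

scan-marks : ∀ x → transition scan (sy x) ≡ just (seekSep , marked x , R)
scan-marks b0  = refl
scan-marks b1  = refl
scan-marks sep = refl

seekSep-passes-input : ∀ v → Pointwise (Sweeps seekSep R) (map sy v) (map sy v)
seekSep-passes-input v = Pointwise.map⁺ sy sy (Pointwise.refl λ { {b0} → refl ; {b1} → refl ; {sep} → refl })

seekEnd-passes-ones : ∀ k → Pointwise (Sweeps seekEnd R) (replicate k in1) (replicate k in1)
seekEnd-passes-ones = Pointwise.replicate⁺ refl

return-passes : ∀ v k → let xs = map sy v ++ tsep ∷ replicate k in1 in Pointwise (Sweeps return L) xs xs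
return-passes v k = Pointwise.++⁺ (Pointwise.map⁺ sy sy (Pointwise.refl λ { {b0} → refl ; {b1} → refl ; {sep} → refl }))
                                  (refl ∷ Pointwise.replicate⁺ refl k)

return-stops : ∀ x → transition return (marked x) ≡ just (scan , marked x , R)
return-stops b0  = refl
return-stops b1  = refl
return-stops sep = refl

unmark-unmarks : ∀ w → Pointwise (Sweeps unmark L) (map marked w) (map sy w)
unmark-unmarks w = Pointwise.map⁺ marked sy (Pointwise.refl λ { {b0} → refl ; {b1} → refl ; {sep} → refl })

unmark-halts : ∀ x → transition unmark (sy x) ≡ just (done , sy x , S)
unmark-halts b0  = refl
unmark-halts b1  = refl
unmark-halts sep = refl

-- The tape right of the input after k rounds; the first round creates the separator.
counter : ℕ → List (Γ appendUnaryLength)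
counter zero    = []
counter (suc k) = tsep ∷ replicate (suc k) in1

seekSep-extends-counter : ∀ k {ls} → ⟨ seekSep ∣ ls ∣ counter k ⟩ ⟶[ 1 ] ⟨ seekEnd ∣ tsep ∷ ls ∣ replicate k in1 ⟩
seekSep-extends-counter zero    = ⟶-trans blank-padding (⟶-step refl)
seekSep-extends-counter (suc k) = ⟶-step refl

replicate-∷ʳ : ∀ {A : Set} k (a : A) → replicate k a ++ a ∷ [] ≡ a ∷ replicate k a
replicate-∷ʳ zero    a = refl
replicate-∷ʳ (suc k) a = cong (a ∷_) (replicate-∷ʳ k a)

round-steps : ∀ v k → let V = map sy v; ones = replicate k in1 in
  1 + (length V + (1 + (length ones + (suc (length (V ++ tsep ∷ ones)) + 1)))) ≡ 2 * (suc (length v) + k) + 3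
round-steps v k = begin
  1 + (length V + (1 + (length ones + (suc (length (V ++ tsep ∷ ones)) + 1))))
    ≡⟨ cong (λ c → 1 + (length V + (1 + (length ones + (suc c + 1))))) (length-++ V) ⟩
  1 + (length V + (1 + (length ones + (suc (length V + suc (length ones)) + 1))))
    ≡⟨ arith (length V) (length ones) ⟩
  2 * (suc (length V) + length ones) + 3
    ≡⟨ cong₂ (λ r k → 2 * (suc r + k) + 3) (length-map sy v) (length-replicate k) ⟩
  2 * (suc (length v) + k) + 3
    ∎
  where
  open ≡-Reasoning
  V = map sy v
  ones = replicate k in1
  arith : ∀ r k → 1 + (r + (1 + (k + (suc (r + suc k) + 1)))) ≡ 2 * (suc r + k) + 3
  arith = solve-∀

round : ∀ x v ū → let k = length ū; U = map marked ū; V = map sy v in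
  ⟨ scan ∣ U ∣ sy x ∷ V ++ counter k ⟩ ⟶[ 2 * (suc (length v) + k) + 3 ] ⟨ scan ∣ marked x ∷ U ∣ V ++ counter (suc k) ⟩
round x v ū = ⟶-cast (round-steps v k) (begin
  ⟨ scan ∣ U ∣ sy x ∷ V ++ counter k ⟩
    ⟶⟨ ⟶-step (scan-marks x) ⟩
  ⟨ seekSep ∣ marked x ∷ U ∣ V ++ counter k ⟩
    ⟶⟨ sweepR (seekSep-passes-input v) ⟩
  ⟨ seekSep ∣ V ʳ++ marked x ∷ U ∣ counter k ⟩
    ⟶⟨ seekSep-extends-counter k ⟩
  ⟨ seekEnd ∣ tsep ∷ V ʳ++ marked x ∷ U ∣ ones ⟩
    ≡⟨ cong ⟨ seekEnd ∣ tsep ∷ V ʳ++ marked x ∷ U ∣_⟩ (sym (++-identityʳ ones)) ⟩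
  ⟨ seekEnd ∣ tsep ∷ V ʳ++ marked x ∷ U ∣ ones ++ [] ⟩
    ⟶⟨ sweepR (seekEnd-passes-ones k) ⟩
  ⟨ seekEnd ∣ ones ʳ++ tsep ∷ V ʳ++ marked x ∷ U ∣ [] ⟩
    ⟶⟨ blank-padding ⟩
  ⟨ seekEnd ∣ ones ʳ++ tsep ∷ V ʳ++ marked x ∷ U ∣ ␣ ∷ [] ⟩
    ≡⟨ cong ⟨ seekEnd ∣_∣ ␣ ∷ [] ⟩ (sym (++-ʳ++ V)) ⟩
  ⟨ seekEnd ∣ (V ++ tsep ∷ ones) ʳ++ marked x ∷ U ∣ ␣ ∷ [] ⟩
    ⟶⟨ sweepL refl (return-passes v k) ⟩
  ⟨ return ∣ U ∣ marked x ∷ (V ++ tsep ∷ ones) ++ in1 ∷ [] ⟩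
    ⟶⟨ ⟶-step (return-stops x) ⟩
  ⟨ scan ∣ marked x ∷ U ∣ (V ++ tsep ∷ ones) ++ in1 ∷ [] ⟩
    ≡⟨ cong ⟨ scan ∣ marked x ∷ U ∣_⟩ counter-grows ⟩
  ⟨ scan ∣ marked x ∷ U ∣ V ++ counter (suc k) ⟩
    ∎)
  where
  open ⟶-Reasoning
  k = length ū
  U = map marked ū
  V = map sy v
  ones = replicate k in1
  counter-grows : (V ++ tsep ∷ ones) ++ in1 ∷ [] ≡ V ++ counter (suc k)
  counter-grows = trans (++-assoc V (tsep ∷ ones) _) (cong (λ os → V ++ tsep ∷ os) (replicate-∷ʳ k in1))

rounds : ∀ v ū {ℓ} → length v + length ū ≡ ℓ →
  ⟨ scan ∣ map marked ū ∣ map sy v ++ counter (length ū) ⟩ ⟶[ length v * (2 * ℓ + 3) ]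
  ⟨ scan ∣ map marked v ʳ++ map marked ū ∣ counter ℓ ⟩
rounds []      ū refl = ⟶-refl
rounds (x ∷ v) ū eq   =
  ⟶-trans (⟶-cast (cong (λ n → 2 * n + 3) eq) (round x v ū)) (rounds v (x ∷ ū) (trans (+-suc (length v) _) eq))

unmarking : ∀ y w → let ℓ = length (y ∷ w) in
  ⟨ scan ∣ map marked (y ∷ w) ʳ++ [] ∣ counter ℓ ⟩ ⟶[ suc ℓ + 1 ] ⟨ done ∣ [] ∣ map sy (y ∷ w) ++ in# ∷ replicate ℓ in1 ⟩
unmarking y w = ⟶-cast (cong (λ n → suc n + 1) (length-map marked (y ∷ w)))
  (⟶-trans (sweepL refl (unmark-unmarks (y ∷ w))) (⟶-step (unmark-halts y)))

appendUnaryLength-computes : ∀ w → 0 < length w →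
  ComputesWithin appendUnaryLength (2 * suc (length w) ^ 2) w (w ++ sep ∷ replicate (length w) b1)
appendUnaryLength-computes w@(y ∷ w′) _ = computesWithin (≤-reflexive (steps (length w))) (begin
  ⟨ scan ∣ [] ∣ map sy w ⟩
    ≡⟨ cong ⟨ scan ∣ [] ∣_⟩ (sym (++-identityʳ (map sy w))) ⟩
  ⟨ scan ∣ [] ∣ map sy w ++ counter 0 ⟩
    ⟶⟨ rounds w [] (+-identityʳ (length w)) ⟩
  ⟨ scan ∣ map marked w ʳ++ [] ∣ counter (length w) ⟩
    ⟶⟨ unmarking y w′ ⟩
  ⟨ done ∣ [] ∣ map sy w ++ in# ∷ replicate (length w) in1 ⟩
    ≡⟨ cong ⟨ done ∣ [] ∣_⟩ output ⟩
  ⟨ done ∣ [] ∣ map sy (w ++ sep ∷ replicate (length w) b1) ⟩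
    ∎)
  where
  open ⟶-Reasoning
  steps : ∀ ℓ → ℓ * (2 * ℓ + 3) + ((1 + ℓ + 1) + 0) ≡ 2 * (1 + ℓ) ^ 2
  steps ℓ = trans (arith ℓ) (cong (λ m → 2 * ((1 + ℓ) * m)) (sym (^-identityʳ (1 + ℓ))))
    where
    arith : ∀ ℓ → ℓ * (2 * ℓ + 3) + ((1 + ℓ + 1) + 0) ≡ 2 * ((1 + ℓ) * (1 + ℓ))
    arith = solve-∀
  output : map sy w ++ in# ∷ replicate (length w) in1 ≡ map sy (w ++ sep ∷ replicate (length w) b1)
  output = sym (trans (map-++ sy w _) (cong (λ os → map sy w ++ in# ∷ os) (map-replicate sy (length w) b1)))

reduce-polytime : PolyTimeComputable encFF encFFT reduce
reduce-polytime = appendUnaryLength , 2 , λ I →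
  subst (ComputesWithin appendUnaryLength _ (encFF I)) (sym (encFFT-reduce I))
        (appendUnaryLength-computes (encFF I) (encFF-nonempty I))

proposition6 : PolyReduction
proposition6 = reduce , reduce-polytime , reduce-correct
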